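{- (i) For every $A\in\mathsf{Form}_{\bot,\supset}$, $\mathbf{S}^-_\bot\vdash A\leftrightarrow (A^{\Box})^{\supset}$. (ii) For every $A\in\mathsf{Form}_{\bot,\Box}$, $\mathbf{L}_4\vdash A\leftrightarrow (A^{\supset})^{\Box}$.
   Context: $\mathsf{Form}_{\bot,\supset}$: formulas built from a countable set $\mathsf{Prop}$ of propositional variables and the constant $\bot$ using binary connectives $\land,\lor,\to,\supset$. $\mathsf{Form}_{\bot,\Box}$: formulas built from $\mathsf{Prop}$ and $\bot$ using $\land,\lor,\to$ and the unary operator $\Box$. $A\leftrightarrow B$ abbreviates $(A\to B)\land(B\to A)$. $\mathbf{S}^-_\bot$ (in $\mathsf{Form}_{\bot,\supset}$) has the axiom schemata: (Ax0) $\bot\to A$; (Ax1) $A\to(B\to A)$; (Ax2) $(A\to(B\to C))\to((A\to B)\to(A\to C))$; (Ax3) $(A\land B)\to A$; (Ax4) $(A\land B)\to B$; (Ax5) $(C\to A)\to((C\to B)\to(C\to(A\land B)))$; (Ax6) $A\to(A\lor B)$; (Ax7) $B\to(A\lor B)$; (Ax8) $(A\to C)\to((B\to C)\to((A\lor B)\to C))$; (AxM1) $(A\to B)\supset(A\supset B)$; (AxM2) $(A\supset(B\supset C))\to((A\supset B)\supset(A\supset C))$; (AxM3) $(A\supset(B\to C))\to(B\to(A\supset C))$; (AxM4) $(A\to(B\supset C))\to(B\supset(A\to C))$; (AxM5) $((A\supset B)\supset C)\to((A\supset C)\to C)$; and the single rule: from $A$ and $A\supset B$ infer $B$. $\mathbf{S}^-_\bot\vdash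 A$ means $A$ is derivable from no assumptions. $\mathbf{L}_4$ (in $\mathsf{Form}_{\bot,\Box}$) has axiom schemata (Ax0)–(Ax8) above (with $\to$ only), plus ($\Box$1) $\Box(A\to B)\to(\Box A\to\Box B)$; ($\Box$2) $\Box A\to A$; ($\Box$3) $\Box A\to\Box\Box A$; ($\Box$4) $\Box A\lor\Box(\Box A\to B)$; and rules: from $A$ infer $\Box A$; from $A$ and $A\to B$ infer $B$. Translations: $(\cdot)^\Box:\mathsf{Form}_{\bot,\supset}\to\mathsf{Form}_{\bot,\Box}$ by $p^\Box=p$, $\bot^\Box=\bot$, $(A\circ B)^\Box=A^\Box\circ B^\Box$ for $\circ\in\{\land,\lor,\to\}$, $(A\supset B)^\Box=\Box(A^\Box)\to B^\Box$. $(\cdot)^\supset:\mathsf{Form}_{\bot,\Box}\to\mathsf{Form}_{\bot,\supset}$ by $p^\supset=p$, $\bot^\supset=\bot$, $(A\circ B)^\supset=A^\supset\circ B^\supset$ for $\circ\in\{\land,\lor,\to\}$, $(\Box A)^\supset=(A^\supset\supset\bot)\supset\bot$. -}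

module Defs where

open import Data.Nat using (ℕ)

Prop : Set
Prop = ℕ

data FormS : Set where
  var  : Prop → FormS
  ⊥'   : FormS
  _∧_  : FormS → FormS → FormS
  _∨_  : FormS → FormS → FormS
  _⇒_  : FormS → FormS → FormS   -- intuitionistic arrow →
  _⊃_  : FormS → FormS → FormS   -- strict implication ⊃

infixr 6 _∧_
infixr 5 _∨_
infixr 4 _⇒_ _⊃_

data FormB : Set where
  var  : Prop → FormB
  ⊥'   : FormB
  _∧_  : FormB → FormB → FormB
  _∨_  : FormB → FormB → FormB
  _⇒_  : FormB → FormB → FormB
  □_   : FormB → FormB

infix 7 □_

_⇔S_ : FormS → FormS → FormS
A ⇔S B = (A ⇒ B) ∧ (B ⇒ A)

_⇔B_ : FormB → FormB → FormB
A ⇔B B = (A ⇒ B) ∧ (B ⇒ A)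

data ⊢S : FormS → Set where
  ax0  : ∀ {A} → ⊢S (⊥' ⇒ A)
  ax1  : ∀ {A B} → ⊢S (A ⇒ (B ⇒ A))
  ax2  : ∀ {A B C} → ⊢S ((A ⇒ (B ⇒ C)) ⇒ ((A ⇒ B) ⇒ (A ⇒ C)))
  ax3  : ∀ {A B} → ⊢S ((A ∧ B) ⇒ A)
  ax4  : ∀ {A B} → ⊢S ((A ∧ B) ⇒ B)
  ax5  : ∀ {A B C} → ⊢S ((C ⇒ A) ⇒ ((C ⇒ B) ⇒ (C ⇒ (A ∧ B))))
  ax6  : ∀ {A B} → ⊢S (A ⇒ (A ∨ B))
  ax7  : ∀ {A B} → ⊢S (B ⇒ (A ∨ B))
  ax8  : ∀ {A B C} → ⊢S ((A ⇒ C) ⇒ ((B ⇒ C) ⇒ ((A ∨ B) ⇒ C)))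
  axM1 : ∀ {A B} → ⊢S ((A ⇒ B) ⊃ (A ⊃ B))
  axM2 : ∀ {A B C} → ⊢S ((A ⊃ (B ⊃ C)) ⇒ ((A ⊃ B) ⊃ (A ⊃ C)))
  axM3 : ∀ {A B C} → ⊢S ((A ⊃ (B ⇒ C)) ⇒ (B ⇒ (A ⊃ C)))
  axM4 : ∀ {A B C} → ⊢S ((A ⇒ (B ⊃ C)) ⇒ (B ⊃ (A ⇒ C)))
  axM5 : ∀ {A B C} → ⊢S (((A ⊃ B) ⊃ C) ⇒ ((A ⊃ C) ⇒ C))
  mp⊃  : ∀ {A B} → ⊢S A → ⊢S (A ⊃ B) → ⊢S B

data ⊢L : FormB → Set where
  ax0  : ∀ {A} → ⊢L (⊥' ⇒ A)
  ax1  : ∀ {A B} → ⊢L (A ⇒ (B ⇒ A))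
  ax2  : ∀ {A B C} → ⊢L ((A ⇒ (B ⇒ C)) ⇒ ((A ⇒ B) ⇒ (A ⇒ C)))
  ax3  : ∀ {A B} → ⊢L ((A ∧ B) ⇒ A)
  ax4  : ∀ {A B} → ⊢L ((A ∧ B) ⇒ B)
  ax5  : ∀ {A B C} → ⊢L ((C ⇒ A) ⇒ ((C ⇒ B) ⇒ (C ⇒ (A ∧ B))))
  ax6  : ∀ {A B} → ⊢L (A ⇒ (A ∨ B))
  ax7  : ∀ {A B} → ⊢L (B ⇒ (A ∨ B))
  ax8  : ∀ {A B C} → ⊢L ((A ⇒ C) ⇒ ((B ⇒ C) ⇒ ((A ∨ B) ⇒ C)))
  □1   : ∀ {A B} → ⊢L (□ (A ⇒ B) ⇒ (□ A ⇒ □ B))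
  □2   : ∀ {A} → ⊢L (□ A ⇒ A)
  □3   : ∀ {A} → ⊢L (□ A ⇒ □ □ A)
  □4   : ∀ {A B} → ⊢L (□ A ∨ □ (□ A ⇒ B))
  nec  : ∀ {A} → ⊢L A → ⊢L (□ A)
  mp   : ∀ {A B} → ⊢L A → ⊢L (A ⇒ B) → ⊢L B

_ᴮ : FormS → FormB
var p ᴮ   = var p
⊥' ᴮ      = ⊥'
(A ∧ B) ᴮ = (A ᴮ) ∧ (B ᴮ)
(A ∨ B) ᴮ = (A ᴮ) ∨ (B ᴮ)
(A ⇒ B) ᴮ = (A ᴮ) ⇒ (B ᴮ)
(A ⊃ B) ᴮ = (□ (A ᴮ)) ⇒ (B ᴮ)

_ˢ : FormB → FormS
var p ˢ   = var p
⊥' ˢ      = ⊥'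
(A ∧ B) ˢ = (A ˢ) ∧ (B ˢ)
(A ∨ B) ˢ = (A ˢ) ∨ (B ˢ)
(A ⇒ B) ˢ = (A ˢ) ⇒ (B ˢ)
(□ A) ˢ   = ((A ˢ) ⊃ ⊥') ⊃ ⊥'

-- Both translations commute with ∧, ∨, ⇒, so each part is an induction whose only
-- real case is the modal connective.  In S⁻, A ⊃ B is equivalent to
-- ((A ⊃ ⊥) ⊃ ⊥) ⇒ B: forwards by AxM5 (with ex falso turning (A ⊃ ⊥) ⊃ ⊥ into
-- (A ⊃ ⊥) ⊃ B), backwards because A strictly implies its strict double negation.
-- In L₄, □ A is equivalent to □ (□ A ⇒ ⊥) ⇒ ⊥: forwards by □ A ⇒ A applied to
-- □ (□ A ⇒ ⊥), backwards by the axiom □ A ∨ □ (□ A ⇒ ⊥).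
module Submission where

open import Defs
open import Data.Product using (_×_; _,_)

module HilbertCalculus
  (Form : Set) (_⟶_ _&_ _+_ : Form → Form → Form) (⊥ : Form) (⊢_ : Form → Set)
  (mp  : ∀ {A B} → ⊢ A → ⊢ (A ⟶ B) → ⊢ B)
  (ax0 : ∀ {A} → ⊢ (⊥ ⟶ A))
  (ax1 : ∀ {A B} → ⊢ (A ⟶ (B ⟶ A)))
  (ax2 : ∀ {A B C} → ⊢ ((A ⟶ (B ⟶ C)) ⟶ ((A ⟶ B) ⟶ (A ⟶ C))))
  (ax3 : ∀ {A B} → ⊢ ((A & B) ⟶ A))
  (ax4 : ∀ {A B} → ⊢ ((A & B) ⟶ B))
  (ax5 : ∀ {A B C} → ⊢ ((C ⟶ A) ⟶ ((C ⟶ B) ⟶ (C ⟶ (A & B)))))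
  (ax6 : ∀ {A B} → ⊢ (A ⟶ (A + B)))
  (ax7 : ∀ {A B} → ⊢ (B ⟶ (A + B)))
  (ax8 : ∀ {A B C} → ⊢ ((A ⟶ C) ⟶ ((B ⟶ C) ⟶ ((A + B) ⟶ C))))
  where

  data Ctx : Set where
    [] : Ctx
    _,,_ : Ctx → Form → Ctx

  _⇛_ : Ctx → Form → Form
  [] ⇛ B = B
  (Γ ,, A) ⇛ B = Γ ⇛ (A ⟶ B)

  -- Hypotheses are kept as curried antecedents, so discharging the last one (ƛ)
  -- is free and the deduction theorem is spread over weaken, _·_ and hyp.
  record _⊩_ (Γ : Ctx) (A : Form) : Set where
    constructor ⟨_⟩
    field closure : ⊢ (Γ ⇛ A)
  open _⊩_

  data _∋_ : Ctx → Form → Set where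
    here  : ∀ {Γ A} → (Γ ,, A) ∋ A
    there : ∀ {Γ A C} → Γ ∋ A → (Γ ,, C) ∋ A

  ⟶-refl : ∀ {A} → ⊢ (A ⟶ A)
  ⟶-refl {A} = mp (ax1 {A} {A}) (mp (ax1 {A} {A ⟶ A}) ax2)

  weaken : ∀ {Γ A} → ⊢ A → Γ ⊩ A
  weaken {[]} a = ⟨ a ⟩
  weaken {Γ ,, C} a = ⟨ closure (weaken {Γ} (mp a ax1)) ⟩

  infixl 5 _·_
  _·_ : ∀ {Γ A B} → Γ ⊩ (A ⟶ B) → Γ ⊩ A → Γ ⊩ B
  _·_ {[]} ⟨ f ⟩ ⟨ a ⟩ = ⟨ mp a f ⟩
  _·_ {Γ ,, C} ⟨ f ⟩ ⟨ a ⟩ = ⟨ closure (weaken {Γ} ax2 · ⟨ f ⟩ · ⟨ a ⟩) ⟩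

  ƛ : ∀ {Γ A B} → (Γ ,, A) ⊩ B → Γ ⊩ (A ⟶ B)
  ƛ ⟨ d ⟩ = ⟨ d ⟩

  hyp : ∀ {Γ A} → Γ ∋ A → Γ ⊩ A
  hyp {Γ ,, A} here = ⟨ closure (weaken {Γ} ⟶-refl) ⟩
  hyp (there x) = ⟨ closure (weaken ax1 · hyp x) ⟩

  #0 : ∀ {Γ A} → (Γ ,, A) ⊩ A
  #0 = hyp here

  #1 : ∀ {Γ A B} → ((Γ ,, A) ,, B) ⊩ A
  #1 = hyp (there here)

  closed : ∀ {A} → [] ⊩ A → ⊢ A
  closed = closure

  pair : ∀ {Γ A B} → Γ ⊩ A → Γ ⊩ B → Γ ⊩ (A & B)
  pair a b = weaken ax5 · weaken ⟶-refl · (weaken ax1 · b) · a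

  fst : ∀ {Γ A B} → Γ ⊩ (A & B) → Γ ⊩ A
  fst = weaken ax3 ·_

  snd : ∀ {Γ A B} → Γ ⊩ (A & B) → Γ ⊩ B
  snd = weaken ax4 ·_

  case : ∀ {Γ A B C} → Γ ⊩ (A ⟶ C) → Γ ⊩ (B ⟶ C) → Γ ⊩ (A + B) → Γ ⊩ C
  case f g x = weaken ax8 · f · g · x

  ⊥-elim : ∀ {Γ A} → Γ ⊩ ⊥ → Γ ⊩ A
  ⊥-elim = weaken ax0 ·_

  ⟶-trans : ∀ {A B C} → ⊢ (A ⟶ B) → ⊢ (B ⟶ C) → ⊢ (A ⟶ C)
  ⟶-trans f g = closed (ƛ (weaken g · (weaken f · #0)))

  _⇔_ : Form → Form → Form
  A ⇔ B = (A ⟶ B) & (B ⟶ A)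

  ⇔-intro : ∀ {A B} → ⊢ (A ⟶ B) → ⊢ (B ⟶ A) → ⊢ (A ⇔ B)
  ⇔-intro f g = closed (pair (weaken f) (weaken g))

  ⇔-fwd : ∀ {A B} → ⊢ (A ⇔ B) → ⊢ (A ⟶ B)
  ⇔-fwd p = closed (fst (weaken p))

  ⇔-bwd : ∀ {A B} → ⊢ (A ⇔ B) → ⊢ (B ⟶ A)
  ⇔-bwd p = closed (snd (weaken p))

  ⇔-refl : ∀ {A} → ⊢ (A ⇔ A)
  ⇔-refl = ⇔-intro ⟶-refl ⟶-refl

  ⇔-trans : ∀ {A B C} → ⊢ (A ⇔ B) → ⊢ (B ⇔ C) → ⊢ (A ⇔ C)
  ⇔-trans p q = ⇔-intro (⟶-trans (⇔-fwd p) (⇔-fwd q)) (⟶-trans (⇔-bwd q) (⇔-bwd p))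

  &-mono : ∀ {A A' B B'} → ⊢ (A ⟶ A') → ⊢ (B ⟶ B') → ⊢ ((A & B) ⟶ (A' & B'))
  &-mono f g = closed (ƛ (pair (weaken f · fst #0) (weaken g · snd #0)))

  +-mono : ∀ {A A' B B'} → ⊢ (A ⟶ A') → ⊢ (B ⟶ B') → ⊢ ((A + B) ⟶ (A' + B'))
  +-mono f g = closed (ƛ (case (ƛ (weaken ax6 · (weaken f · #0)))
                               (ƛ (weaken ax7 · (weaken g · #0))) #0))

  ⟶-mono : ∀ {A A' B B'} → ⊢ (A' ⟶ A) → ⊢ (B ⟶ B') → ⊢ ((A ⟶ B) ⟶ (A' ⟶ B'))
  ⟶-mono f g = closed (ƛ (ƛ (weaken g · (#1 · (weaken f · #0)))))

  &-cong : ∀ {A A' B B'} → ⊢ (A ⇔ A') → ⊢ (B ⇔ B') → ⊢ ((A & B) ⇔ (A' & B'))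
  &-cong p q = ⇔-intro (&-mono (⇔-fwd p) (⇔-fwd q)) (&-mono (⇔-bwd p) (⇔-bwd q))

  +-cong : ∀ {A A' B B'} → ⊢ (A ⇔ A') → ⊢ (B ⇔ B') → ⊢ ((A + B) ⇔ (A' + B'))
  +-cong p q = ⇔-intro (+-mono (⇔-fwd p) (⇔-fwd q)) (+-mono (⇔-bwd p) (⇔-bwd q))

  ⟶-cong : ∀ {A A' B B'} → ⊢ (A ⇔ A') → ⊢ (B ⇔ B') → ⊢ ((A ⟶ B) ⇔ (A' ⟶ B'))
  ⟶-cong p q = ⇔-intro (⟶-mono (⇔-bwd p) (⇔-fwd q)) (⟶-mono (⇔-fwd p) (⇔-bwd q))

⊢S-mp : ∀ {A B} → ⊢S A → ⊢S (A ⇒ B) → ⊢S B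
⊢S-mp a f = mp⊃ a (mp⊃ f axM1)

module S = HilbertCalculus FormS _⇒_ _∧_ _∨_ ⊥' ⊢S ⊢S-mp ax0 ax1 ax2 ax3 ax4 ax5 ax6 ax7 ax8
open S using (weaken; _·_; ƛ; #0; #1; closed)

⇒-to-⊃ : ∀ {A B} → ⊢S (A ⇒ B) → ⊢S (A ⊃ B)
⇒-to-⊃ f = mp⊃ f axM1

⊃-const : ∀ {A B} → ⊢S B → ⊢S (A ⊃ B)
⊃-const b = ⇒-to-⊃ (⊢S-mp b ax1)

⊃-ap : ∀ {A B C} → ⊢S (A ⊃ (B ⊃ C)) → ⊢S (A ⊃ B) → ⊢S (A ⊃ C)
⊃-ap f a = mp⊃ a (⊢S-mp f axM2)

⊃-trans : ∀ {A B C} → ⊢S (A ⊃ B) → ⊢S (B ⊃ C) → ⊢S (A ⊃ C)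
⊃-trans f g = ⊃-ap (⊃-const g) f

⊃-trans-⇒ : ∀ {A B C} → ⊢S (A ⊃ B) → ⊢S (B ⇒ C) → ⊢S (A ⊃ C)
⊃-trans-⇒ f g = ⊃-trans f (⇒-to-⊃ g)

⇒-implies-⊃ : ∀ {A B} → ⊢S ((A ⇒ B) ⇒ (A ⊃ B))
⇒-implies-⊃ = ⊢S-mp (⇒-to-⊃ (closed (ƛ (ƛ (#0 · #1))))) axM3

⊃-eval : ∀ {A B} → ⊢S (A ⊃ ((A ⊃ B) ⇒ B))
⊃-eval = ⊢S-mp S.⟶-refl axM4

⊃-monoʳ : ∀ {A B B'} → ⊢S (B ⇒ B') → ⊢S ((A ⊃ B) ⇒ (A ⊃ B'))
⊃-monoʳ g = ⊢S-mp (⊃-trans-⇒ ⊃-eval (S.⟶-mono S.⟶-refl g)) axM3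

⊃-antitoneˡ : ∀ {A A' B} → ⊢S (A' ⇒ A) → ⊢S ((A ⊃ B) ⇒ (A' ⊃ B))
⊃-antitoneˡ f = ⊢S-mp (⊃-trans (⇒-to-⊃ f) ⊃-eval) axM3

⊃-cong : ∀ {A A' B B'} → ⊢S (A ⇔S A') → ⊢S (B ⇔S B') → ⊢S ((A ⊃ B) ⇔S (A' ⊃ B'))
⊃-cong p q = S.⇔-intro
  (S.⟶-trans (⊃-monoʳ (S.⇔-fwd q)) (⊃-antitoneˡ (S.⇔-bwd p)))
  (S.⟶-trans (⊃-monoʳ (S.⇔-bwd q)) (⊃-antitoneˡ (S.⇔-fwd p)))

boxˢ : FormS → FormS
boxˢ A = (A ⊃ ⊥') ⊃ ⊥'

⊃-boxˢ : ∀ {A} → ⊢S (A ⊃ boxˢ A)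
⊃-boxˢ = ⊃-trans-⇒ ⊃-eval ⇒-implies-⊃

⊃⇔boxˢ⇒ : ∀ {A B} → ⊢S ((A ⊃ B) ⇔S (boxˢ A ⇒ B))
⊃⇔boxˢ⇒ = S.⇔-intro
  (closed (ƛ (ƛ (weaken axM5 · (weaken (⊃-monoʳ ax0) · #0) · #1))))
  (⊢S-mp (⊃-trans-⇒ ⊃-boxˢ (closed (ƛ (ƛ (#0 · #1))))) axM3)

S-roundtrip : (A : FormS) → ⊢S (A ⇔S ((A ᴮ) ˢ))
S-roundtrip (var p) = S.⇔-refl
S-roundtrip ⊥'      = S.⇔-refl
S-roundtrip (A ∧ B) = S.&-cong (S-roundtrip A) (S-roundtrip B)
S-roundtrip (A ∨ B) = S.+-cong (S-roundtrip A) (S-roundtrip B)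
S-roundtrip (A ⇒ B) = S.⟶-cong (S-roundtrip A) (S-roundtrip B)
S-roundtrip (A ⊃ B) = S.⇔-trans (⊃-cong (S-roundtrip A) (S-roundtrip B)) ⊃⇔boxˢ⇒

module L = HilbertCalculus FormB _⇒_ _∧_ _∨_ ⊥' ⊢L mp ax0 ax1 ax2 ax3 ax4 ax5 ax6 ax7 ax8

□-mono : ∀ {A B} → ⊢L (A ⇒ B) → ⊢L (□ A ⇒ □ B)
□-mono f = mp (nec f) □1

□-cong : ∀ {A B} → ⊢L (A ⇔B B) → ⊢L ((□ A) ⇔B (□ B))
□-cong p = L.⇔-intro (□-mono (L.⇔-fwd p)) (□-mono (L.⇔-bwd p))

□⇔¬□¬□ : ∀ {A} → ⊢L ((□ A) ⇔B (□ (□ A ⇒ ⊥') ⇒ ⊥'))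
□⇔¬□¬□ = L.⇔-intro
  (L.closed (L.ƛ (L.ƛ (L.weaken □2 L.· L.#0 L.· L.#1))))
  (L.closed (L.ƛ (L.case (L.weaken L.⟶-refl) (L.ƛ (L.⊥-elim (L.#1 L.· L.#0))) (L.weaken □4))))

L-roundtrip : (A : FormB) → ⊢L (A ⇔B ((A ˢ) ᴮ))
L-roundtrip (var p) = L.⇔-refl
L-roundtrip ⊥'      = L.⇔-refl
L-roundtrip (A ∧ B) = L.&-cong (L-roundtrip A) (L-roundtrip B)
L-roundtrip (A ∨ B) = L.+-cong (L-roundtrip A) (L-roundtrip B)
L-roundtrip (A ⇒ B) = L.⟶-cong (L-roundtrip A) (L-roundtrip B)
L-roundtrip (□ A)   = L.⇔-trans (□-cong (L-roundtrip A)) □⇔¬□¬□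

mainTheorem9 : ((A : FormS) → ⊢S (A ⇔S ((A ᴮ) ˢ))) × ((A : FormB) → ⊢L (A ⇔B ((A ˢ) ᴮ)))
mainTheorem9 = S-roundtrip , L-roundtrip
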